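{- Let $n\ge 0$ and $q\ge 1$. Let $\mathcal{B}_n(1^{q+1})$ be the set of binary words of length $n$ with no factor $1^{q+1}$, and $\mathcal{W}^q_n$ the set of $q$-decreasing binary words of length $n$. Define $\psi$ on binary words of any length $m$ by $\psi(v\,0\,1^k)=v\,0\,0\,1^{k+q}$ (for any binary word $v$ and $k\ge 0$) and $\psi(1^m)=1^{m+q+1}$. Define $\phi$ recursively on binary words avoiding $1^{q+1}$ by $$\phi(w)=\begin{cases}1^k & \text{if } w=1^k,\ 0\le k\le q,\\ \psi(\phi(v)) & \text{if } w=1^q0v,\\ \phi(v)\,0\,1^k & \text{if } w=1^k0v,\ 0\le k\le q-1.\end{cases}$$ Then $\phi$ restricted to $\mathcal{B}_n(1^{q+1})$ is a bijection onto $\mathcal{W}^q_n$. Consequently $|\mathcal{W}^q_n|=|\mathcal{B}_n(1^{q+1})|$.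
   Context: A binary word is $q$-decreasing ($q\ge1$) if each of its maximal factors (maximal blocks of consecutive letters) of the form $0^a1^b$ with $a>0$ satisfies $q\cdot a>b$. $u^k$ denotes $k$ concatenated copies of $u$; $1^0$ is the empty word. -}

module Defs where

open import Data.Nat using (ℕ; zero; suc; _+_; _*_; _<_)
open import Data.Nat using (_≡ᵇ_)
open import Data.Bool using (Bool; true; false; if_then_else_)
open import Data.List using (List; []; _∷_; _++_; replicate; reverse; length; [_])
open import Data.Product using (Σ; ∃; _×_; _,_)
open import Relation.Binary.PropositionalEquality using (_≡_)
open import Relation.Nullary using (¬_)

-- Binary words: lists of Bool, with false = letter 0 and true = letter 1.
Word : Set
Word = List Bool

0^ : ℕ → Word
0^ a = replicate a false

1^ : ℕ → Word
1^ b = replicate b true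

Avoids1 : ℕ → Word → Set
Avoids1 q w = ¬ (Σ Word λ x → Σ Word λ y → w ≡ x ++ 1^ (suc q) ++ y)

-- The occurrence  w = x · 0^a 1^b · y  (a > 0) is a MAXIMAL factor of the
-- form 0^a 1^b : it cannot be extended to the left (x does not end in 0),
-- nor to the right (y does not start with 1, and if b = 0 then y does not
-- start with 0 either, i.e. y is empty).
MaximalOcc : Word → ℕ → ℕ → Word → Set
MaximalOcc x a b y =
  (¬ (Σ Word λ x' → x ≡ x' ++ [ false ]))
  × (¬ (Σ Word λ y' → y ≡ true ∷ y'))
  × (b ≡ 0 → y ≡ [])

QDecreasing : ℕ → Word → Set
QDecreasing q w =
  (x : Word) (a b : ℕ) (y : Word) →
  w ≡ x ++ 0^ a ++ 1^ b ++ y → 0 < a → MaximalOcc x a b y → b < q * a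

-- ψ(v 0 1^k) = v 0 0 1^(k+q),  ψ(1^m) = 1^(m+q+1).
-- Implemented by scanning the reversed word, counting trailing 1s.
psiRev : ℕ → ℕ → Word → Word
psiRev q k [] = 1^ (k + q + 1)
psiRev q k (true ∷ r) = psiRev q (suc k) r
psiRev q k (false ∷ r) = reverse r ++ false ∷ false ∷ 1^ (k + q)

ψ : ℕ → Word → Word
ψ q w = psiRev q 0 (reverse w)

-- φ, by recursion: phiAux q k w computes φ(1^k w), scanning leading 1s.
--   φ(1^k)      = 1^k
--   φ(1^q 0 v)  = ψ(φ(v))
--   φ(1^k 0 v)  = φ(v) 0 1^k     (k ≠ q; for words avoiding 1^(q+1) this
--                                 means 0 ≤ k ≤ q-1; other k are outside
--                                 the domain and the value is irrelevant)
phiAux : ℕ → ℕ → Word → Word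
phiAux q k [] = 1^ k
phiAux q k (true ∷ w) = phiAux q (suc k) w
phiAux q k (false ∷ v) =
  if k ≡ᵇ q then ψ q (phiAux q 0 v) else (phiAux q 0 v ++ false ∷ 1^ k)

φ : ℕ → Word → Word
φ q w = phiAux q 0 w

-- Reading words backwards turns φ into a left-to-right construction: R w = reverse (φ q w)
-- satisfies R (1^k) = 1^k, R (1^k 0 v) = 1^k 0 R v for k < q and R (1^q 0 v) = rψ (R v), where
-- rψ sends 1^m to 1^(m+q+1) and 1^m 0 z to 1^(m+q) 0 0 z.  The words avoiding 1^(q+1) are
-- exactly those generated by these three clauses.  On the other side, u is q-decreasing iff
-- reverse u is a sequence of maximal factors 1^m 0^(a+1) with m < q(a+1) followed by a block of
-- ones.  These reversed words are generated by the same three clauses, and, for q ≥ 1, uniquely: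
-- the shapes 1^k (k ≤ q), 1^k 0 r (k < q) and rψ r are pairwise disjoint and rψ is injective.
-- Hence R is a length-preserving bijection between the two sets.

module Submission where

open import Defs
open import Data.Bool using (true; false; if_then_else_)
open import Data.Empty using (⊥-elim)
open import Data.List using (List; []; _∷_; _++_; replicate; reverse; length; [_]; _∷ʳ_; initLast; _∷ʳ′_)
open import Data.List.Properties
  using (++-assoc; ++-identityʳ; length-++; length-++-≤ʳ; length-replicate; length-reverse;
         reverse-++; reverse-involutive; reverse-selfInverse; reverse-injective; unfold-reverse;
         ∷-injective; ∷-injectiveˡ; ∷-injectiveʳ; ∷ʳ-injectiveʳ)
open import Data.Nat using (ℕ; zero; suc; _+_; _*_; _≤_; _<_; _≟_; _≤?_; _<?_; z≤n; s≤s)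
open import Data.Nat.Induction using (<-wellFounded)
open import Data.Nat.Properties
  using (≤-refl; ≤-trans; <-≤-trans; <⇒≤; <⇒≢; <⇒≱; ≤⇒≯; ≰⇒>; ≮⇒≥; m≤n⇒m<n∨m≡n; m≤n⇒∃[o]m+o≡n;
         m≤m+n; m≤m*n; m<m+n; +-comm; +-suc; +-cancelˡ-≡; +-cancelˡ-<; +-monoʳ-<; *-suc; *-identityʳ)
open import Data.Nat.Tactic.RingSolver using (solve-∀)
open import Data.Product using (Σ; ∃; ∃₂; _×_; _,_; map₁)
open import Data.Sum using (inj₁; inj₂)
open import Function using (_∘_)
open import Induction.WellFounded using (Acc; acc)
open import Relation.Binary.PropositionalEquality
  using (_≡_; _≢_; refl; sym; trans; cong; cong₂; subst; module ≡-Reasoning)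
open import Relation.Nullary using (¬_; yes; no)
open import Relation.Nullary.Decidable using (dec-true; dec-false)

module _ {A : Set} where

  StartsWith : A → List A → Set
  StartsWith x xs = Σ (List A) λ ys → xs ≡ x ∷ ys

  EndsWith : A → List A → Set
  EndsWith x xs = Σ (List A) λ ys → xs ≡ ys ++ [ x ]

  replicate-+ : ∀ m n (x : A) → replicate (m + n) x ≡ replicate m x ++ replicate n x
  replicate-+ zero    n x = refl
  replicate-+ (suc m) n x = cong (x ∷_) (replicate-+ m n x)

  replicate-++-∷ : ∀ m (x : A) xs → replicate m x ++ x ∷ xs ≡ replicate (suc m) x ++ xs
  replicate-++-∷ zero    x xs = refl
  replicate-++-∷ (suc m) x xs = cong (x ∷_) (replicate-++-∷ m x xs)

  replicate-∷ʳ : ∀ m (x : A) → replicate m x ∷ʳ x ≡ replicate (suc m) x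
  replicate-∷ʳ m x = trans (replicate-++-∷ m x []) (++-identityʳ _)

  reverse-replicate : ∀ m (x : A) → reverse (replicate m x) ≡ replicate m x
  reverse-replicate zero    x = refl
  reverse-replicate (suc m) x = begin
    reverse (x ∷ replicate m x)  ≡⟨ unfold-reverse x (replicate m x) ⟩
    reverse (replicate m x) ∷ʳ x ≡⟨ cong (_∷ʳ x) (reverse-replicate m x) ⟩
    replicate m x ∷ʳ x           ≡⟨ replicate-∷ʳ m x ⟩
    replicate (suc m) x          ∎
    where open ≡-Reasoning

  replicate-injective : ∀ m n {x : A} → replicate m x ≡ replicate n x → m ≡ n
  replicate-injective m n e = trans (sym (length-replicate m)) (trans (cong length e) (length-replicate n))

  replicate≢++-∷ : ∀ m {x y : A} xs {ys} → x ≢ y → replicate m x ≢ xs ++ y ∷ ys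
  replicate≢++-∷ zero    []       x≢y ()
  replicate≢++-∷ zero    (_ ∷ _)  x≢y ()
  replicate≢++-∷ (suc m) []       x≢y e = x≢y (∷-injectiveˡ e)
  replicate≢++-∷ (suc m) (_ ∷ xs) x≢y e = replicate≢++-∷ m xs x≢y (∷-injectiveʳ e)

  replicate-++-injective : ∀ m n {x : A} {xs ys} → ¬ StartsWith x xs → ¬ StartsWith x ys →
                           replicate m x ++ xs ≡ replicate n x ++ ys → m ≡ n × xs ≡ ys
  replicate-++-injective zero    zero    _   _   e = refl , e
  replicate-++-injective zero    (suc n) ¬xs _   e = ⊥-elim (¬xs (_ , e))
  replicate-++-injective (suc m) zero    _   ¬ys e = ⊥-elim (¬ys (_ , sym e))
  replicate-++-injective (suc m) (suc n) ¬xs ¬ys e =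
    map₁ (cong suc) (replicate-++-injective m n ¬xs ¬ys (∷-injectiveʳ e))

  reverse-++₃ : ∀ (xs ys zs : List A) → reverse (xs ++ ys ++ zs) ≡ reverse zs ++ reverse ys ++ reverse xs
  reverse-++₃ xs ys zs = begin
    reverse (xs ++ ys ++ zs)                  ≡⟨ reverse-++ xs (ys ++ zs) ⟩
    reverse (ys ++ zs) ++ reverse xs          ≡⟨ cong (_++ reverse xs) (reverse-++ ys zs) ⟩
    (reverse zs ++ reverse ys) ++ reverse xs  ≡⟨ ++-assoc (reverse zs) (reverse ys) (reverse xs) ⟩
    reverse zs ++ reverse ys ++ reverse xs    ∎
    where open ≡-Reasoning

  reverse-++-replicate : ∀ xs ys m (x : A) →
                         reverse (xs ++ ys ++ replicate m x) ≡ replicate m x ++ reverse ys ++ reverse xs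
  reverse-++-replicate xs ys m x =
    trans (reverse-++₃ xs ys (replicate m x)) (cong (_++ reverse ys ++ reverse xs) (reverse-replicate m x))

  reverse-factor : ∀ xs m (x : A) n y ys →
                   reverse (xs ++ replicate m x ++ replicate n y ++ ys)
                   ≡ reverse ys ++ replicate n y ++ replicate m x ++ reverse xs
  reverse-factor xs m x n y ys = begin
    reverse (xs ++ replicate m x ++ replicate n y ++ ys)
      ≡⟨ reverse-++₃ xs (replicate m x) (replicate n y ++ ys) ⟩
    reverse (replicate n y ++ ys) ++ reverse (replicate m x) ++ reverse xs
      ≡⟨ cong (λ u → reverse (replicate n y ++ ys) ++ u ++ reverse xs) (reverse-replicate m x) ⟩
    reverse (replicate n y ++ ys) ++ replicate m x ++ reverse xs
      ≡⟨ cong (_++ replicate m x ++ reverse xs) (reverse-++ (replicate n y) ys) ⟩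
    (reverse ys ++ reverse (replicate n y)) ++ replicate m x ++ reverse xs
      ≡⟨ ++-assoc (reverse ys) _ _ ⟩
    reverse ys ++ reverse (replicate n y) ++ replicate m x ++ reverse xs
      ≡⟨ cong (λ u → reverse ys ++ u ++ replicate m x ++ reverse xs) (reverse-replicate n y) ⟩
    reverse ys ++ replicate n y ++ replicate m x ++ reverse xs
      ∎
    where open ≡-Reasoning

  EndsWith-reverse⁻ : ∀ {x : A} {xs} → EndsWith x (reverse xs) → StartsWith x xs
  EndsWith-reverse⁻ {x} (ys , e) = reverse ys , trans (sym (reverse-selfInverse e)) (reverse-++ ys [ x ])

  StartsWith-reverse⁻ : ∀ {x : A} {xs} → StartsWith x (reverse xs) → EndsWith x xs
  StartsWith-reverse⁻ {x} (ys , e) = reverse ys , trans (sym (reverse-selfInverse e)) (unfold-reverse x ys)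

  EndsWith-++ˡ : ∀ {x : A} xs {ys} → EndsWith x ys → EndsWith x (xs ++ ys)
  EndsWith-++ˡ {x} xs (ys , refl) = xs ++ ys , sym (++-assoc xs ys [ x ])

  EndsWith-unique : ∀ {x y : A} {xs} → EndsWith x xs → EndsWith y xs → x ≡ y
  EndsWith-unique (ys , refl) (zs , e) = ∷ʳ-injectiveʳ ys zs e

  ¬EndsWith-[] : ∀ {x : A} → ¬ EndsWith x []
  ¬EndsWith-[] ([] , ())
  ¬EndsWith-[] (_ ∷ _ , ())

  ¬EndsWith-++ : ∀ {x : A} xs {ys} → ¬ EndsWith x ys → (ys ≡ [] → ¬ EndsWith x xs) →
                 ¬ EndsWith x (xs ++ ys)
  ¬EndsWith-++ xs {ys} ¬ys ¬xs with initLast ys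
  ... | []        = λ (zs , e) → ¬xs refl (zs , trans (sym (++-identityʳ xs)) e)
  ... | ys′ ∷ʳ′ y = λ (zs , e) → ¬ys (ys′ , cong (ys′ ∷ʳ_)
                      (∷ʳ-injectiveʳ (xs ++ ys′) zs (trans (++-assoc xs ys′ [ y ]) e)))

length-<-1^-++-∷ : ∀ m {c} w → length w < length (1^ m ++ c ∷ w)
length-<-1^-++-∷ m {c} w = length-++-≤ʳ (c ∷ w) {1^ m}

data OnesView : Word → Set where
  all-ones : ∀ m → OnesView (1^ m)
  ones-0   : ∀ m w → OnesView (1^ m ++ false ∷ w)

onesView : ∀ w → OnesView w
onesView []          = all-ones 0
onesView (false ∷ w) = ones-0 0 w
onesView (true ∷ w) with onesView w
... | all-ones m  = all-ones (suc m)
... | ones-0 m w′ = ones-0 (suc m) w′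

zeros-split : ∀ w → ∃₂ λ a z → w ≡ 0^ a ++ z × ¬ StartsWith false z
zeros-split []          = 0 , [] , refl , λ ()
zeros-split (true ∷ w)  = 0 , true ∷ w , refl , λ ()
zeros-split (false ∷ w) with zeros-split w
... | a , z , refl , ¬0z = suc a , z , refl , ¬0z

ones-prefix : ∀ m {c y s u} → ¬ EndsWith true (c ∷ y) → (c ∷ y) ++ true ∷ s ≡ 1^ m ++ u →
              ∃ λ y′ → c ∷ y ≡ 1^ m ++ y′ × u ≡ y′ ++ true ∷ s
ones-prefix zero    ¬1 e = _ , refl , sym e
ones-prefix (suc m) {y = []} ¬1 e with ∷-injectiveˡ e
... | refl = ⊥-elim (¬1 ([] , refl))
ones-prefix (suc m) {y = _ ∷ _} ¬1 e with ∷-injective e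
... | refl , e′ with ones-prefix m (¬1 ∘ EndsWith-++ˡ [ true ]) e′
... | y′ , y≡ , u≡ = y′ , cong (true ∷_) y≡ , u≡

zeros-prefix : ∀ a {y s z} → y ++ true ∷ s ≡ 0^ a ++ z →
               ∃ λ y′ → y ≡ 0^ a ++ y′ × z ≡ y′ ++ true ∷ s
zeros-prefix zero    {y}     e = y , refl , sym e
zeros-prefix (suc a) {[]}    ()
zeros-prefix (suc a) {_ ∷ _} e with ∷-injective e
... | refl , e′ with zeros-prefix a e′
... | y′ , y≡ , z≡ = y′ , cong (false ∷_) y≡ , z≡

module _ {B : Set} (f : ℕ → Word → B) (f-true : ∀ j w → f j (true ∷ w) ≡ f (suc j) w) where

  count-1^-++ : ∀ j m w → f j (1^ m ++ w) ≡ f (j + m) w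
  count-1^-++ j zero    w = cong (λ i → f i w) (sym (+-comm j 0))
  count-1^-++ j (suc m) w = trans (f-true j (1^ m ++ w))
    (trans (count-1^-++ (suc j) m w) (cong (λ i → f i w) (sym (+-suc j m))))

module _ (q : ℕ) where

  Avoids1-suffix : ∀ xs {ys} → Avoids1 q (xs ++ ys) → Avoids1 q ys
  Avoids1-suffix xs av (x , y , e) = av (xs ++ x , y , trans (cong (xs ++_) e) (sym (++-assoc xs x _)))

  Avoids1-false∷ : ∀ {w} → Avoids1 q w → Avoids1 q (false ∷ w)
  Avoids1-false∷ av ([] , y , ())
  Avoids1-false∷ av (_ ∷ x , y , e) = av (x , y , ∷-injectiveʳ e)

  Avoids1⇒≤ : ∀ k {w} → Avoids1 q (1^ k ++ w) → k ≤ q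
  Avoids1⇒≤ k {w} av with k ≤? q
  ... | yes k≤q = k≤q
  ... | no k≰q with m≤n⇒∃[o]m+o≡n (≰⇒> k≰q)
  ... | d , refl = ⊥-elim (av ([] , 1^ d ++ w ,
          trans (cong (_++ w) (replicate-+ (suc q) d true)) (++-assoc (1^ (suc q)) (1^ d) w)))

  1^-++-prefix : ∀ k n {v y} → k < n → 1^ k ++ v ≡ 1^ n ++ y → StartsWith true v
  1^-++-prefix zero    (suc n) _         e = _ , e
  1^-++-prefix (suc k) (suc n) (s≤s k<n) e = 1^-++-prefix k n k<n (∷-injectiveʳ e)

  Avoids1-1^-++ : ∀ k {v} → k ≤ q → ¬ StartsWith true v → Avoids1 q v → Avoids1 q (1^ k ++ v)
  Avoids1-1^-++ zero    _ _  av = av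
  Avoids1-1^-++ (suc k) k<q ¬1 av ([] , y , e) = ¬1 (1^-++-prefix (suc k) (suc q) (s≤s k<q) e)
  Avoids1-1^-++ (suc k) k<q ¬1 av (_ ∷ x , y , e) = Avoids1-1^-++ k (<⇒≤ k<q) ¬1 av (x , y , ∷-injectiveʳ e)

  data Avoiding : Word → Set where
    short : ∀ {k} → k ≤ q → Avoiding (1^ k)
    block : ∀ {k v} → k < q → Avoiding v → Avoiding (1^ k ++ false ∷ v)
    wrap  : ∀ {v} → Avoiding v → Avoiding (1^ q ++ false ∷ v)

  avoiding : ∀ {w} → Avoids1 q w → Avoiding w
  avoiding {w} = scan 0 w
    where
    scan : ∀ k w → Avoids1 q (1^ k ++ w) → Avoiding (1^ k ++ w)
    scan k [] av = subst Avoiding (sym (++-identityʳ _)) (short (Avoids1⇒≤ k av))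
    scan k (true ∷ w) av = subst Avoiding (sym (replicate-++-∷ k true w))
      (scan (suc k) w (subst (Avoids1 q) (replicate-++-∷ k true w) av))
    scan k (false ∷ v) av with m≤n⇒m<n∨m≡n (Avoids1⇒≤ k av)
                             | scan 0 v (Avoids1-suffix [ false ] (Avoids1-suffix (1^ k) av))
    ... | inj₁ k<q  | av-v = block k<q av-v
    ... | inj₂ refl | av-v = wrap av-v

  avoids : ∀ {w} → Avoiding w → Avoids1 q w
  avoids (short {k} k≤q) = subst (Avoids1 q) (++-identityʳ _)
    (Avoids1-1^-++ k k≤q (λ ()) λ { ([] , _ , ()) ; (_ ∷ _ , _ , ()) })
  avoids (block {k} k<q av) = Avoids1-1^-++ k (<⇒≤ k<q) (λ ()) (Avoids1-false∷ (avoids av))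
  avoids (wrap av)          = Avoids1-1^-++ q ≤-refl (λ ()) (Avoids1-false∷ (avoids av))

  φ-1^-++ : ∀ k w → φ q (1^ k ++ w) ≡ phiAux q k w
  φ-1^-++ = count-1^-++ (phiAux q) (λ _ _ → refl) 0

  φ-1^ : ∀ k → φ q (1^ k) ≡ 1^ k
  φ-1^ k = trans (cong (φ q) (sym (++-identityʳ (1^ k)))) (φ-1^-++ k [])

  φ-block : ∀ {k} → k ≢ q → ∀ v → φ q (1^ k ++ false ∷ v) ≡ φ q v ++ false ∷ 1^ k
  φ-block {k} k≢q v = trans (φ-1^-++ k (false ∷ v))
    (cong (λ b → if b then ψ q (φ q v) else (φ q v ++ false ∷ 1^ k)) (dec-false (k ≟ q) k≢q))

  φ-wrap : ∀ v → φ q (1^ q ++ false ∷ v) ≡ ψ q (φ q v)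
  φ-wrap v = trans (φ-1^-++ q (false ∷ v))
    (cong (λ b → if b then ψ q (φ q v) else (φ q v ++ false ∷ 1^ q)) (dec-true (q ≟ q) refl))

  R : Word → Word
  R w = reverse (φ q w)

  rψ : Word → Word
  rψ r = reverse (psiRev q 0 r)

  R-1^ : ∀ k → R (1^ k) ≡ 1^ k
  R-1^ k = trans (cong reverse (φ-1^ k)) (reverse-replicate k true)

  R-block : ∀ {k} → k ≢ q → ∀ v → R (1^ k ++ false ∷ v) ≡ 1^ k ++ false ∷ R v
  R-block {k} k≢q v = trans (cong reverse (φ-block k≢q v)) (reverse-++-replicate (φ q v) [ false ] k true)

  R-wrap : ∀ v → R (1^ q ++ false ∷ v) ≡ rψ (R v)
  R-wrap v = cong reverse (φ-wrap v)

  rψ-1^ : ∀ m → rψ (1^ m) ≡ 1^ (suc q + m)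
  rψ-1^ m = begin
    reverse (psiRev q 0 (1^ m))      ≡⟨ cong (reverse ∘ psiRev q 0) (sym (++-identityʳ (1^ m))) ⟩
    reverse (psiRev q 0 (1^ m ++ [])) ≡⟨ cong reverse (count-1^-++ (psiRev q) (λ _ _ → refl) 0 m []) ⟩
    reverse (1^ (m + q + 1))         ≡⟨ reverse-replicate (m + q + 1) true ⟩
    1^ (m + q + 1)                   ≡⟨ cong 1^ (arithmetic m q) ⟩
    1^ (suc q + m)                   ∎
    where
    open ≡-Reasoning
    arithmetic : ∀ m q → m + q + 1 ≡ suc q + m
    arithmetic = solve-∀

  rψ-block : ∀ m z → rψ (1^ m ++ false ∷ z) ≡ 1^ (q + m) ++ false ∷ false ∷ z
  rψ-block m z = begin
    reverse (psiRev q 0 (1^ m ++ false ∷ z))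
      ≡⟨ cong reverse (count-1^-++ (psiRev q) (λ _ _ → refl) 0 m (false ∷ z)) ⟩
    reverse (reverse z ++ (false ∷ false ∷ []) ++ 1^ (m + q))
      ≡⟨ reverse-++-replicate (reverse z) (false ∷ false ∷ []) (m + q) true ⟩
    1^ (m + q) ++ false ∷ false ∷ reverse (reverse z)
      ≡⟨ cong₂ (λ n u → 1^ n ++ false ∷ false ∷ u) (+-comm m q) (reverse-involutive z) ⟩
    1^ (q + m) ++ false ∷ false ∷ z
      ∎
    where open ≡-Reasoning

  length-rψ : ∀ r → length (rψ r) ≡ length r + suc q
  length-rψ r with onesView r
  ... | all-ones m = begin
    length (rψ (1^ m))       ≡⟨ cong length (rψ-1^ m) ⟩
    length (1^ (suc q + m))  ≡⟨ length-replicate (suc q + m) ⟩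
    suc q + m                ≡⟨ +-comm (suc q) m ⟩
    m + suc q                ≡⟨ cong (_+ suc q) (sym (length-replicate m)) ⟩
    length (1^ m) + suc q    ∎
    where open ≡-Reasoning
  ... | ones-0 m z = begin
    length (rψ (1^ m ++ false ∷ z))             ≡⟨ cong length (rψ-block m z) ⟩
    length (1^ (q + m) ++ false ∷ false ∷ z)    ≡⟨ length-++ (1^ (q + m)) ⟩
    length (1^ (q + m)) + suc (suc (length z))  ≡⟨ cong (_+ suc (suc (length z))) (length-replicate (q + m)) ⟩
    q + m + suc (suc (length z))                ≡⟨ arithmetic q m (length z) ⟩
    m + suc (length z) + suc q                  ≡⟨ cong (λ n → n + suc (length z) + suc q) (sym (length-replicate m)) ⟩
    length (1^ m) + suc (length z) + suc q      ≡⟨ cong (_+ suc q) (sym (length-++ (1^ m))) ⟩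
    length (1^ m ++ false ∷ z) + suc q          ∎
    where
    open ≡-Reasoning
    arithmetic : ∀ q m l → q + m + suc (suc l) ≡ m + suc l + suc q
    arithmetic = solve-∀

  1^≢rψ : ∀ {k} r → k ≤ q → 1^ k ≢ rψ r
  1^≢rψ {k} r k≤q e with onesView r
  ... | all-ones m = ≤⇒≯ k≤q
          (subst (q <_) (sym (replicate-injective k _ (trans e (rψ-1^ m)))) (s≤s (m≤m+n q m)))
  ... | ones-0 m z = replicate≢++-∷ k (1^ (q + m)) (λ ()) (trans e (rψ-block m z))

  block≢rψ : ∀ {k u} r → k < q → 1^ k ++ false ∷ u ≢ rψ r
  block≢rψ {k} r k<q e with onesView r
  ... | all-ones m = replicate≢++-∷ (suc q + m) (1^ k) (λ ()) (sym (trans e (rψ-1^ m)))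
  ... | ones-0 m z with replicate-++-injective k (q + m) (λ ()) (λ ()) (trans e (rψ-block m z))
  ... | refl , _ = <⇒≱ k<q (m≤m+n q m)

  rψ-injective : ∀ {r r′} → rψ r ≡ rψ r′ → r ≡ r′
  rψ-injective {r} {r′} e with onesView r | onesView r′
  ... | all-ones m | all-ones m′ = cong 1^ (+-cancelˡ-≡ (suc q) m m′
          (replicate-injective _ _ (trans (sym (rψ-1^ m)) (trans e (rψ-1^ m′)))))
  ... | all-ones m | ones-0 m′ z′ = ⊥-elim (replicate≢++-∷ (suc q + m) (1^ (q + m′)) (λ ())
          (trans (sym (rψ-1^ m)) (trans e (rψ-block m′ z′))))
  ... | ones-0 m z | all-ones m′ = ⊥-elim (replicate≢++-∷ (suc q + m′) (1^ (q + m)) (λ ())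
          (trans (sym (rψ-1^ m′)) (trans (sym e) (rψ-block m z))))
  ... | ones-0 m z | ones-0 m′ z′
      with replicate-++-injective (q + m) (q + m′) (λ ()) (λ ())
             (trans (sym (rψ-block m z)) (trans e (rψ-block m′ z′)))
  ... | q+m≡q+m′ , refl = cong (λ n → 1^ n ++ false ∷ z) (+-cancelˡ-≡ q m m′ q+m≡q+m′)

  data RevDecreasing : Word → Set where
    ones   : ∀ m → RevDecreasing (1^ m)
    factor : ∀ {m a z} → m < q * suc a → ¬ StartsWith false z → RevDecreasing z →
             RevDecreasing (1^ m ++ 0^ (suc a) ++ z)

  MaximalOccʳ : Word → ℕ → Word → Set
  MaximalOccʳ y b x = ¬ EndsWith true y × ¬ StartsWith false x × (b ≡ 0 → y ≡ [])

  QDecreasingʳ : Word → Set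
  QDecreasingʳ r = ∀ y b a x → r ≡ y ++ 1^ b ++ 0^ a ++ x → 0 < a → MaximalOccʳ y b x → b < q * a

  QDecreasing⇒QDecreasingʳ : ∀ {r} → QDecreasing q (reverse r) → QDecreasingʳ r
  QDecreasing⇒QDecreasingʳ D y b a x e 0<a (¬y1 , ¬0x , y≡[]) =
    D (reverse x) a b (reverse y) (trans (cong reverse e) (reverse-factor y b true a false x)) 0<a
      (¬0x ∘ EndsWith-reverse⁻ , ¬y1 ∘ StartsWith-reverse⁻ , cong reverse ∘ y≡[])

  QDecreasingʳ⇒QDecreasing : ∀ {r} → QDecreasingʳ r → QDecreasing q (reverse r)
  QDecreasingʳ⇒QDecreasing {r} D x a b y e 0<a (¬x0 , ¬1y , y≡[]) =
    D (reverse y) b a (reverse x)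
      (trans (sym (reverse-involutive r)) (trans (cong reverse e) (reverse-factor x a false b true y))) 0<a
      (¬1y ∘ EndsWith-reverse⁻ , ¬x0 ∘ StartsWith-reverse⁻ , cong reverse ∘ y≡[])

  RevDecreasing⇒QDecreasingʳ : ∀ {r} → RevDecreasing r → QDecreasingʳ r
  RevDecreasing⇒QDecreasingʳ _ y b zero x e () _
  RevDecreasing⇒QDecreasingʳ (ones m) y b (suc a) x e _ _ =
    ⊥-elim (replicate≢++-∷ m (y ++ 1^ b) (λ ()) (trans e (sym (++-assoc y (1^ b) _))))
  RevDecreasing⇒QDecreasingʳ (factor {m} {a} m<qa ¬0z _) [] b (suc a′) x e _ (_ , ¬0x , _)
    with replicate-++-injective m b (λ ()) (λ ()) e
  ... | refl , e′ with replicate-++-injective a a′ ¬0z ¬0x (∷-injectiveʳ e′)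
  ... | refl , _ = m<qa
  RevDecreasing⇒QDecreasingʳ (factor _ _ _) (_ ∷ _) zero (suc _) _ _ _ (_ , _ , y≡[]) with y≡[] refl
  ... | ()
  RevDecreasing⇒QDecreasingʳ (factor {m} {a} _ _ d) (c ∷ y) (suc b) (suc a′) x e 0<a (¬y1 , ¬0x , _)
    with ones-prefix m ¬y1 (sym e)
  ... | y₁ , y≡ , e₁ with zeros-prefix (suc a) (sym e₁)
  ... | y₂ , refl , z≡ = RevDecreasing⇒QDecreasingʳ d y₂ (suc b) (suc a′) x z≡ 0<a
          ( ¬y1 ∘ subst (EndsWith true) (sym y≡) ∘ EndsWith-++ˡ (1^ m) ∘ EndsWith-++ˡ (0^ (suc a))
          , ¬0x , λ ())

  QDecreasingʳ-suffix : ∀ m a {z} → ¬ StartsWith false z → QDecreasingʳ (1^ m ++ 0^ (suc a) ++ z) →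
                        QDecreasingʳ z
  QDecreasingʳ-suffix m a ¬0z D y zero zero x e () _
  QDecreasingʳ-suffix m a ¬0z D y zero (suc a′) x e _ (_ , _ , y≡[]) with y≡[] refl
  ... | refl = ⊥-elim (¬0z (_ , e))
  QDecreasingʳ-suffix m a {z} ¬0z D y (suc b) a′ x e 0<a′ (¬y1 , ¬0x , _) =
    D (P ++ y) (suc b) a′ x e′ 0<a′ (¬EndsWith-++ P ¬y1 (λ { refl → ¬P1 }) , ¬0x , λ ())
    where
    P : Word
    P = 1^ m ++ 0^ (suc a)
    e′ : 1^ m ++ 0^ (suc a) ++ z ≡ (P ++ y) ++ 1^ (suc b) ++ 0^ a′ ++ x
    e′ = trans (sym (++-assoc (1^ m) (0^ (suc a)) z)) (trans (cong (P ++_) e) (sym (++-assoc P y _)))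
    ¬P1 : ¬ EndsWith true P
    ¬P1 P1 with EndsWith-unique P1 (EndsWith-++ˡ (1^ m) (0^ a , sym (replicate-∷ʳ a false)))
    ... | ()

  QDecreasingʳ⇒RevDecreasing : ∀ {r} → QDecreasingʳ r → RevDecreasing r
  QDecreasingʳ⇒RevDecreasing {r} = build r (<-wellFounded (length r))
    where
    build : ∀ r → Acc _<_ (length r) → QDecreasingʳ r → RevDecreasing r
    build r (acc rs) D with onesView r
    ... | all-ones m = ones m
    ... | ones-0 m r′ with zeros-split r′
    ... | a , z , refl , ¬0z =
      factor (D [] m (suc a) z refl (s≤s z≤n) (¬EndsWith-[] , ¬0z , λ _ → refl)) ¬0z
        (build z (rs shorter) (QDecreasingʳ-suffix m a ¬0z D))
      where
      shorter : length z < length (1^ m ++ 0^ (suc a) ++ z)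
      shorter = ≤-trans (s≤s (length-++-≤ʳ z {0^ a})) (length-<-1^-++-∷ m (0^ a ++ z))

  RevDecreasing⇒QDecreasing : ∀ {r} → RevDecreasing r → QDecreasing q (reverse r)
  RevDecreasing⇒QDecreasing = QDecreasingʳ⇒QDecreasing ∘ RevDecreasing⇒QDecreasingʳ

  QDecreasing⇒RevDecreasing : ∀ {r} → QDecreasing q (reverse r) → RevDecreasing r
  QDecreasing⇒RevDecreasing = QDecreasingʳ⇒RevDecreasing ∘ QDecreasing⇒QDecreasingʳ

  <q⇒<q*suc : ∀ {k} a → k < q → k < q * suc a
  <q⇒<q*suc a k<q = <-≤-trans k<q (m≤m*n q (suc a))

  RevDecreasing-block : ∀ {k r} → k < q → RevDecreasing r → RevDecreasing (1^ k ++ false ∷ r)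
  RevDecreasing-block k<q (ones zero)    = factor (<q⇒<q*suc 0 k<q) (λ ()) (ones 0)
  RevDecreasing-block k<q (ones (suc m)) = factor (<q⇒<q*suc 0 k<q) (λ ()) (ones (suc m))
  RevDecreasing-block k<q (factor {zero} {a} _ ¬0z d) = factor (<q⇒<q*suc (suc a) k<q) ¬0z d
  RevDecreasing-block k<q d@(factor {suc _} _ _ _)    = factor (<q⇒<q*suc 0 k<q) (λ ()) d

  RevDecreasing-rψ : ∀ {r} → RevDecreasing r → RevDecreasing (rψ r)
  RevDecreasing-rψ (ones m) = subst RevDecreasing (sym (rψ-1^ m)) (ones (suc q + m))
  RevDecreasing-rψ (factor {m} {a} {z} m<qa ¬0z d) = subst RevDecreasing (sym (rψ-block m (0^ a ++ z)))
    (factor (subst (q + m <_) (sym (*-suc q (suc a))) (+-monoʳ-< q m<qa)) ¬0z d)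

  data RevDecreasingView : Word → Set where
    short : ∀ {k} → k ≤ q → RevDecreasingView (1^ k)
    block : ∀ {k r} → k < q → RevDecreasing r → RevDecreasingView (1^ k ++ false ∷ r)
    wrap  : ∀ {r} → RevDecreasing r → RevDecreasingView (rψ r)

  revDecreasingView : 1 ≤ q → ∀ {r} → RevDecreasing r → RevDecreasingView r
  revDecreasingView _ (ones m) with m ≤? q
  ... | yes m≤q = short m≤q
  ... | no m≰q with m≤n⇒∃[o]m+o≡n (≰⇒> m≰q)
  ... | d , refl = subst RevDecreasingView (rψ-1^ d) (wrap (ones d))
  revDecreasingView _ (factor {m} {zero} m<q ¬0z d) = block (subst (m <_) (*-identityʳ q) m<q) d
  revDecreasingView q≥1 (factor {m} {suc a} {z} m<qa ¬0z d) with m <? q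
  ... | yes m<q = block m<q (factor {0} (<q⇒<q*suc a q≥1) ¬0z d)
  ... | no m≮q with m≤n⇒∃[o]m+o≡n (≮⇒≥ m≮q)
  ... | e , refl = subst RevDecreasingView (rψ-block e (0^ a ++ z)) (wrap (factor e<qa ¬0z d))
    where
    e<qa : e < q * suc a
    e<qa = +-cancelˡ-< q e (q * suc a) (subst (q + e <_) (*-suc q (suc a)) m<qa)

  image : ∀ {w} → Avoiding w → Word
  image (short {k} _)    = 1^ k
  image (block {k} _ av) = 1^ k ++ false ∷ image av
  image (wrap av)        = rψ (image av)

  R-image : ∀ {w} (av : Avoiding w) → R w ≡ image av
  R-image (short {k} _)          = R-1^ k
  R-image (block {k} {v} k<q av) = trans (R-block (<⇒≢ k<q) v) (cong (λ u → 1^ k ++ false ∷ u) (R-image av))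
  R-image (wrap {v} av)          = trans (R-wrap v) (cong rψ (R-image av))

  length-image : ∀ {w} (av : Avoiding w) → length (image av) ≡ length w
  length-image (short {k} _) = refl
  length-image (block {k} {v} _ av) = begin
    length (1^ k ++ false ∷ image av)      ≡⟨ length-++ (1^ k) ⟩
    length (1^ k) + suc (length (image av)) ≡⟨ cong (λ n → length (1^ k) + suc n) (length-image av) ⟩
    length (1^ k) + suc (length v)         ≡⟨ length-++ (1^ k) ⟨
    length (1^ k ++ false ∷ v)             ∎
    where open ≡-Reasoning
  length-image (wrap {v} av) = begin
    length (rψ (image av))          ≡⟨ length-rψ (image av) ⟩
    length (image av) + suc q       ≡⟨ cong (_+ suc q) (length-image av) ⟩
    length v + suc q                ≡⟨ +-comm (length v) (suc q) ⟩
    suc (q + length v)              ≡⟨ +-suc q (length v) ⟨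
    q + suc (length v)              ≡⟨ cong (_+ suc (length v)) (length-replicate q) ⟨
    length (1^ q) + suc (length v)  ≡⟨ length-++ (1^ q) ⟨
    length (1^ q ++ false ∷ v)      ∎
    where open ≡-Reasoning

  image-RevDecreasing : ∀ {w} (av : Avoiding w) → RevDecreasing (image av)
  image-RevDecreasing (short {k} _)  = ones k
  image-RevDecreasing (block k<q av) = RevDecreasing-block k<q (image-RevDecreasing av)
  image-RevDecreasing (wrap av)      = RevDecreasing-rψ (image-RevDecreasing av)

  image-injective : ∀ {w w′} (av : Avoiding w) (av′ : Avoiding w′) → image av ≡ image av′ → w ≡ w′
  image-injective (short {k} _)     (short {k′} _)      e = cong 1^ (replicate-injective k k′ e)
  image-injective (short {k} _)     (block {k′} _ _)    e = ⊥-elim (replicate≢++-∷ k (1^ k′) (λ ()) e)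
  image-injective (short k≤q)       (wrap av′)          e = ⊥-elim (1^≢rψ (image av′) k≤q e)
  image-injective (block {k} _ _)   (short {k′} _)      e = ⊥-elim (replicate≢++-∷ k′ (1^ k) (λ ()) (sym e))
  image-injective (block {k} _ av)  (block {k′} _ av′)  e with replicate-++-injective k k′ (λ ()) (λ ()) e
  ... | refl , e′ = cong (λ v → 1^ k ++ false ∷ v) (image-injective av av′ (∷-injectiveʳ e′))
  image-injective (block k<q _)     (wrap av′)          e = ⊥-elim (block≢rψ (image av′) k<q e)
  image-injective (wrap av)         (short k′≤q)        e = ⊥-elim (1^≢rψ (image av) k′≤q (sym e))
  image-injective (wrap av)         (block k′<q _)      e = ⊥-elim (block≢rψ (image av) k′<q (sym e))
  image-injective (wrap av)         (wrap av′)          e =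
    cong (λ v → 1^ q ++ false ∷ v) (image-injective av av′ (rψ-injective e))

  image-surjective : 1 ≤ q → ∀ {r} → RevDecreasing r →
                     Σ Word λ w → Σ (Avoiding w) λ av → image av ≡ r
  image-surjective q≥1 {r} = unfold r (<-wellFounded (length r))
    where
    unfold : ∀ r → Acc _<_ (length r) → RevDecreasing r →
             Σ Word λ w → Σ (Avoiding w) λ av → image av ≡ r
    unfold r (acc rs) d with revDecreasingView q≥1 d
    ... | short {k} k≤q = 1^ k , short k≤q , refl
    ... | block {k} {r′} k<q d′ with unfold r′ (rs (length-<-1^-++-∷ k r′)) d′
    ... | w , av , refl = 1^ k ++ false ∷ w , block k<q av , refl
    unfold r (acc rs) d | wrap {r′} d′
      with unfold r′ (rs (subst (length r′ <_) (sym (length-rψ r′)) (m<m+n (length r′) (s≤s z≤n)))) d′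
    ... | w , av , refl = 1^ q ++ false ∷ w , wrap av , refl

  φ-length : ∀ {w} → Avoids1 q w → length (φ q w) ≡ length w
  φ-length {w} av = begin
    length (φ q w)                ≡⟨ length-reverse (φ q w) ⟨
    length (R w)                  ≡⟨ cong length (R-image (avoiding av)) ⟩
    length (image (avoiding av))  ≡⟨ length-image (avoiding av) ⟩
    length w                      ∎
    where open ≡-Reasoning

  φ-QDecreasing : ∀ {w} → Avoids1 q w → QDecreasing q (φ q w)
  φ-QDecreasing {w} av = subst (QDecreasing q) (reverse-involutive (φ q w))
    (RevDecreasing⇒QDecreasing (subst RevDecreasing (sym (R-image (avoiding av)))
      (image-RevDecreasing (avoiding av))))

  φ-injective : ∀ {w w′} → Avoids1 q w → Avoids1 q w′ → φ q w ≡ φ q w′ → w ≡ w′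
  φ-injective av av′ e = image-injective (avoiding av) (avoiding av′)
    (trans (sym (R-image (avoiding av))) (trans (cong reverse e) (R-image (avoiding av′))))

  φ-surjective : 1 ≤ q → ∀ {u} → QDecreasing q u →
                 Σ Word λ w → length w ≡ length u × Avoids1 q w × φ q w ≡ u
  φ-surjective q≥1 {u} du with image-surjective q≥1
    (QDecreasing⇒RevDecreasing (subst (QDecreasing q) (sym (reverse-involutive u)) du))
  ... | w , av , image≡ = w , |w|≡|u| , avoids av , reverse-injective (trans (R-image av) image≡)
    where
    |w|≡|u| : length w ≡ length u
    |w|≡|u| = trans (sym (length-image av)) (trans (cong length image≡) (length-reverse u))

theorem1 : (n q : ℕ) → 1 ≤ q →
    ((w : Word) → length w ≡ n → Avoids1 q w →
       length (φ q w) ≡ n × QDecreasing q (φ q w))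
    × ((w w' : Word) → length w ≡ n → Avoids1 q w →
       length w' ≡ n → Avoids1 q w' → φ q w ≡ φ q w' → w ≡ w')
    × ((u : Word) → length u ≡ n → QDecreasing q u →
       Σ Word (λ w → length w ≡ n × Avoids1 q w × φ q w ≡ u))
theorem1 n q q≥1 =
    (λ w |w|≡n av → trans (φ-length q av) |w|≡n , φ-QDecreasing q av)
  , (λ w w′ _ av _ av′ → φ-injective q av av′)
  , λ u |u|≡n du → let (w , |w|≡|u| , av , φw≡u) = φ-surjective q q≥1 du
                   in  w , trans |w|≡|u| |u|≡n , av , φw≡u
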